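{- Define $d:\mathfrak{A}\to\mathfrak{A}$ by $d(w)=b_0\sqcup\!\sqcup\,w-b_0w$. Then $d$ is a derivation of $\mathfrak{A}$ (for concatenation), and for a formal parameter $u$ $$\exp(du)(w)=(1-b_0u)\big((1-b_0u)^{ -1}\sqcup\!\sqcup\,w\big)\qquad(w\in\mathfrak{A}^1).$$ On the generators, $\exp(du)(a)=a(1-b_0u)^{ -1}$ and $\exp(du)(b_j)=b_j(1-b_0u)^{ -1}$ for $j=0,\dots,N-1$.
   Context: Fix an integer $N\ge1$. Let $\mathfrak{A}=\mathbb{Q}\langle a,b_0,\dots,b_{N-1}\rangle$ be the free noncommutative $\mathbb{Q}$-algebra (concatenation written as juxtaposition, unit = empty word $\mathbf{1}=1$); $\mathfrak{A}^1$ is the span of words not ending in $a$. The shuffle product: bilinear, $\mathbf{1}\sqcup\!\sqcup w=w\sqcup\!\sqcup\mathbf{1}=w$, $xu'\sqcup\!\sqcup yv=x(u'\sqcup\!\sqcup yv)+y(xu'\sqcup\!\sqcup v)$ for letters $x,y$ and words $u',v$. $\exp(du)=\sum_{n\ge0}d^nu^n/n!$ and $(1-b_0u)^{ -1}=\sum_{n\ge0}b_0^nu^n$; all identities are in $\mathfrak{A}[[u]]$. -}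

module Defs where

open import Data.Nat using (ℕ; zero; suc; _∸_; _!)
open import Data.Nat.Properties using (_!≢0)
import Data.Fin
open import Data.Fin using (Fin)
import Data.Fin.Properties as FinP
open import Data.List using (List; []; _∷_; _++_; map; concatMap; replicate; upTo)
import Data.List.Properties as ListP
open import Data.Product using (_×_; _,_)
open import Data.Integer using (+_)
open import Data.Rational using (ℚ; 0ℚ; 1ℚ; _+_; _*_; -_; _/_)
open import Relation.Binary.PropositionalEquality using (_≡_; refl; cong)
open import Relation.Nullary using (yes; no)
open import Relation.Binary.Definitions using (DecidableEquality)

module Alg (N : ℕ) where

  data Letter : Set where
    a : Letter
    b : Fin N → Letter

  _≟L_ : DecidableEquality Letter
  a ≟L a = yes refl
  a ≟L b _ = no λ ()
  b _ ≟L a = no λ ()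
  b i ≟L b j with FinP._≟_ i j
  ... | yes refl = yes refl
  ... | no i≢j = no λ { refl → i≢j refl }

  Word : Set
  Word = List Letter

  _≟W_ : DecidableEquality Word
  _≟W_ = ListP.≡-dec _≟L_

  -- An element of 𝔄: a finite formal Q-linear combination of words
  -- (list of (coefficient , word) terms; equal words are added up by 'coeff').
  Poly : Set
  Poly = List (ℚ × Word)

  coeff : Poly → Word → ℚ
  coeff [] w = 0ℚ
  coeff ((c , v) ∷ p) w with v ≟W w
  ... | yes _ = c + coeff p w
  ... | no _  = coeff p w

  infix 4 _≈_
  _≈_ : Poly → Poly → Set
  p ≈ q = ∀ w → coeff p w ≡ coeff q w

  mon : Word → Poly
  mon w = (1ℚ , w) ∷ []

  0P : Poly
  0P = []

  1P : Poly
  1P = mon []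

  infixl 6 _⊕_ _⊖_
  infixl 7 _•_ _·_

  _⊕_ : Poly → Poly → Poly
  p ⊕ q = p ++ q

  _•_ : ℚ → Poly → Poly
  c • p = map (λ { (c' , w) → (c * c' , w) }) p

  _⊖_ : Poly → Poly → Poly
  p ⊖ q = p ⊕ (- 1ℚ) • q

  _·_ : Poly → Poly → Poly
  p · q = concatMap (λ { (c , v) → map (λ { (c' , w) → (c * c' , v ++ w) }) q }) p

  -- shuffle of two words, as the list (multiset) of resulting words:
  --   1 ⧢ w = w ⧢ 1 = w ,  xu ⧢ yv = x(u ⧢ yv) + y(xu ⧢ v)
  shW : Word → Word → List Word
  shW [] v = v ∷ []
  shW (x ∷ u) v = go v
    where
    go : Word → List Word
    go [] = (x ∷ u) ∷ []
    go (y ∷ v') = map (x ∷_) (shW u (y ∷ v')) ++ map (y ∷_) (go v')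

  infixl 7 _⧢_
  _⧢_ : Poly → Poly → Poly
  p ⧢ q = concatMap (λ { (c , v) → concatMap (λ { (c' , w) →
            map (λ s → (c * c' , s)) (shW v w) }) q }) p

  EndsInA : Word → Set
  EndsInA w = Data.Product.Σ Word (λ v → w ≡ v ++ (a ∷ []))

  InA1 : Poly → Set
  InA1 p = ∀ w → EndsInA w → coeff p w ≡ 0ℚ

  IsDerivation : (Poly → Poly) → Set
  IsDerivation D =
    (∀ p q → p ≈ q → D p ≈ D q) Data.Product.×
    (∀ p q → D (p ⊕ q) ≈ D p ⊕ D q) Data.Product.×
    (∀ c p → D (c • p) ≈ c • D p) Data.Product.×
    (∀ p q → D (p · q) ≈ D p · q ⊕ p · D q)

  -- formal power series in u with coefficients in 𝔄 : n ↦ coefficient of u^n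
  Series : Set
  Series = ℕ → Poly

  infix 4 _≈s_
  _≈s_ : Series → Series → Set
  f ≈s g = ∀ n → f n ≈ g n

  sumP : List Poly → Poly
  sumP [] = 0P
  sumP (p ∷ ps) = p ⊕ sumP ps

  const : Poly → Series
  const p zero = p
  const p (suc _) = 0P

  -- product in 𝔄[[u]] (u central): Cauchy product w.r.t. concatenation
  _⊙_ : Series → Series → Series
  (f ⊙ g) n = sumP (map (λ i → f i · g (n ∸ i)) (upTo (suc n)))

  -- shuffle in 𝔄[[u]] (u a scalar parameter): Cauchy product w.r.t. ⧢
  _⧢s_ : Series → Series → Series
  (f ⧢s g) n = sumP (map (λ i → f i ⧢ g (n ∸ i)) (upTo (suc n)))

  iter : ℕ → (Poly → Poly) → Poly → Poly
  iter zero D p = p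
  iter (suc n) D p = D (iter n D p)

  expSeries : (Poly → Poly) → Poly → Series
  expSeries D w n = ((+ 1 / n !) {{n !≢0}}) • iter n D w

-- Objects needing b_0 (so N ≥ 1): we write N = suc M.
module AlgB (M : ℕ) where
  open Alg (suc M)

  b0 : Letter
  b0 = b Fin.zero

  d : Poly → Poly
  d w = mon (b0 ∷ []) ⧢ w ⊖ mon (b0 ∷ []) · w

  oneMinusB0u : Series
  oneMinusB0u zero = 1P
  oneMinusB0u (suc zero) = (- 1ℚ) • mon (b0 ∷ [])
  oneMinusB0u (suc (suc _)) = 0P

  -- (1 − b_0 u)^{-1} = Σ_n b_0^n u^n
  geomB0 : Series
  geomB0 n = mon (replicate n b0)

{-# OPTIONS --safe #-}
module Submission where

-- Write L = x ⧢ _ and C = x · _ for the letter x = b₀, so that d = L − C.  The shuffle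
-- recursion gives the commutation rule L (y · p) = x · y · p + y · L p for every letter y,
-- i.e. d (y · p) = y · L p; the Leibniz rule follows by induction on the left factor.
-- The same rule gives L (xⁿ ⧢ p) = (n+1) xⁿ⁺¹ ⧢ p.  Hence, for Rₙ = xⁿ ⧢ p − x · (xⁿ⁻¹ ⧢ p),
-- the coefficient of uⁿ in (1 − x u)((1 − x u)⁻¹ ⧢ p), one gets d Rₙ = (n+1) Rₙ₊₁, so
-- dⁿ p = n! Rₙ, which is the identity coefficientwise.  On a letter y the shuffles collapse
-- and Rₙ = y xⁿ.

open import Defs
open import Data.Nat as ℕ using (ℕ; zero; suc; _∸_; _!; s≤s)
import Data.Nat.Properties as ℕ
open import Data.Nat.Properties using (_!≢0)
import Data.Nat.Coprimality as Coprimality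
import Data.Integer as ℤ
import Data.Integer.Properties as ℤ
open import Data.Fin using (Fin)
open import Data.List using (List; []; _∷_; _++_; map; replicate; upTo; applyUpTo; length; filter)
import Data.List.Properties as List
open import Data.Product using (_×_; _,_; proj₂)
open import Data.Rational using (ℚ; mkℚ; 0ℚ; 1ℚ; _+_; _*_; -_; _-_; _/_; toℚᵘ)
open import Data.Rational.Properties
open import Data.Rational.Unnormalised using (*≡*)
import Data.Rational.Unnormalised.Properties as ℚᵘ
open import Data.Rational.Solver using (module +-*-Solver)
open import Data.Empty using (⊥-elim)
open import Relation.Binary.PropositionalEquality
open import Relation.Nullary using (yes; no; ¬?)
open import Relation.Binary.Bundles using (Setoid)
open import Relation.Binary.Structures using (IsEquivalence)
open import Level using (0ℓ)
open import Algebra.Bundles using (CommutativeSemigroup)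
import Relation.Binary.Reasoning.Setoid

open +-*-Solver using (solve; _:=_; _:+_; _:*_; _:-_; :-_; con)

-- Built with mkℚ (rather than _/_) so that toℚᵘ (ι n) computes to n/1.
ι : ℕ → ℚ
ι n = mkℚ (ℤ.+ n) 0 (Coprimality.sym (Coprimality.1-coprimeTo n))

ι-+ : ∀ m n → ι m + ι n ≡ ι (m ℕ.+ n)
ι-+ m n = toℚᵘ-injective (ℚᵘ.≃-trans (toℚᵘ-homo-+ (ι m) (ι n)) (*≡* (begin
  (ℤ.+ m ℤ.* ℤ.+ 1 ℤ.+ ℤ.+ n ℤ.* ℤ.+ 1) ℤ.* ℤ.+ 1  ≡⟨ ℤ.*-identityʳ _ ⟩
  ℤ.+ m ℤ.* ℤ.+ 1 ℤ.+ ℤ.+ n ℤ.* ℤ.+ 1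
    ≡⟨ cong₂ ℤ._+_ (ℤ.*-identityʳ (ℤ.+ m)) (ℤ.*-identityʳ (ℤ.+ n)) ⟩
  ℤ.+ m ℤ.+ ℤ.+ n                                ≡⟨ ℤ.pos-+ m n ⟨
  ℤ.+ (m ℕ.+ n)                                  ≡⟨ ℤ.*-identityʳ _ ⟨
  ℤ.+ (m ℕ.+ n) ℤ.* ℤ.+ 1                        ∎)))
  where open ≡-Reasoning

ι-suc : ∀ n → ι (suc n) ≡ 1ℚ + ι n
ι-suc n = sym (ι-+ 1 n)

ι-* : ∀ m n → ι m * ι n ≡ ι (m ℕ.* n)
ι-* m n = toℚᵘ-injective (ℚᵘ.≃-trans (toℚᵘ-homo-* (ι m) (ι n))
  (*≡* (cong (ℤ._* ℤ.+ 1) (sym (ℤ.pos-* m n)))))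

1/n*ι[n]≡1 : ∀ n .{{_ : ℕ.NonZero n}} → (ℤ.+ 1 / n) * ι n ≡ 1ℚ
1/n*ι[n]≡1 (suc k) =
  trans (cong (_* ι (suc k)) (normalize-coprime (Coprimality.1-coprimeTo (suc k))))
        (*-inverseˡ (ι (suc k)))

module Coefficients (N : ℕ) where
  open Alg N

  indicator : Word → Word → ℚ
  indicator w v = coeff (mon v) w

  indicator-self : ∀ w → indicator w w ≡ 1ℚ
  indicator-self w with w ≟W w
  ... | yes _   = +-identityʳ 1ℚ
  ... | no w≢w = ⊥-elim (w≢w refl)

  indicator-other : ∀ {v w} → v ≢ w → indicator w v ≡ 0ℚ
  indicator-other {v} {w} v≢w with v ≟W w
  ... | yes v≡w = ⊥-elim (v≢w v≡w)
  ... | no _    = refl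

  coeff-∷ : ∀ c v p w → coeff ((c , v) ∷ p) w ≡ c * indicator w v + coeff p w
  coeff-∷ c v p w with v ≟W w
  ... | yes _ = cong (_+ coeff p w) (sym (trans (cong (c *_) (+-identityʳ 1ℚ)) (*-identityʳ c)))
  ... | no _  = sym (trans (cong (_+ coeff p w) (*-zeroʳ c)) (+-identityˡ _))

  coeff-∷-self : ∀ c v p → coeff ((c , v) ∷ p) v ≡ c + coeff p v
  coeff-∷-self c v p =
    trans (coeff-∷ c v p v) (cong (_+ coeff p v) (trans (cong (c *_) (indicator-self v)) (*-identityʳ c)))

  coeff-∷-other : ∀ c {v w} p → v ≢ w → coeff ((c , v) ∷ p) w ≡ coeff p w
  coeff-∷-other c {v} {w} p v≢w = trans (coeff-∷ c v p w)
    (trans (cong (_+ coeff p w) (trans (cong (c *_) (indicator-other v≢w)) (*-zeroʳ c))) (+-identityˡ _))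

  extend : (Word → ℚ) → Poly → ℚ
  extend g [] = 0ℚ
  extend g ((c , v) ∷ p) = c * g v + extend g p

  coeff-as-extend : ∀ p w → coeff p w ≡ extend (indicator w) p
  coeff-as-extend [] w = refl
  coeff-as-extend ((c , v) ∷ p) w =
    trans (coeff-∷ c v p w) (cong ((c * indicator w v) +_) (coeff-as-extend p w))

  extend-++ : ∀ g p q → extend g (p ++ q) ≡ extend g p + extend g q
  extend-++ g [] q = sym (+-identityˡ _)
  extend-++ g ((c , v) ∷ p) q =
    trans (cong (_+_ (c * g v)) (extend-++ g p q)) (sym (+-assoc (c * g v) (extend g p) (extend g q)))

  extend-• : ∀ g k p → extend g (k • p) ≡ k * extend g p
  extend-• g k [] = sym (*-zeroʳ k)
  extend-• g k ((c , v) ∷ p) =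
    trans (cong₂ _+_ (*-assoc k c (g v)) (extend-• g k p)) (sym (*-distribˡ-+ k _ _))

  extend-cong : ∀ {g h} → (∀ v → g v ≡ h v) → ∀ p → extend g p ≡ extend h p
  extend-cong g≗h [] = refl
  extend-cong g≗h ((c , v) ∷ p) = cong₂ _+_ (cong (c *_) (g≗h v)) (extend-cong g≗h p)

  extend-+ : ∀ g h p → extend (λ v → g v + h v) p ≡ extend g p + extend h p
  extend-+ g h [] = sym (+-identityˡ 0ℚ)
  extend-+ g h ((c , v) ∷ p) = trans (cong₂ _+_ (*-distribˡ-+ c (g v) (h v)) (extend-+ g h p))
    (solve 4 (λ a b x y → (a :+ b) :+ (x :+ y) := (a :+ x) :+ (b :+ y)) refl
           (c * g v) (c * h v) (extend g p) (extend h p))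

  extend-* : ∀ k g p → extend (λ v → k * g v) p ≡ k * extend g p
  extend-* k g [] = sym (*-zeroʳ k)
  extend-* k g ((c , v) ∷ p) =
    trans (cong₂ _+_ (solve 3 (λ c k x → c :* (k :* x) := k :* (c :* x)) refl c k (g v)) (extend-* k g p))
          (sym (*-distribˡ-+ k _ _))

  extend-zero : ∀ p → extend (λ _ → 0ℚ) p ≡ 0ℚ
  extend-zero [] = refl
  extend-zero ((c , v) ∷ p) = trans (cong₂ _+_ (*-zeroʳ c) (extend-zero p)) (+-identityˡ 0ℚ)

  extend-mon : ∀ g u → extend g (mon u) ≡ g u
  extend-mon g u = trans (+-identityʳ _) (*-identityˡ _)

  extend-swap : ∀ (K : Word → Word → ℚ) p q →
    extend (λ v → extend (K v) q) p ≡ extend (λ v′ → extend (λ v → K v v′) p) q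
  extend-swap K [] q = sym (extend-zero q)
  extend-swap K ((c , v) ∷ p) q = trans (cong₂ _+_ (sym (extend-* c (K v) q)) (extend-swap K p q))
    (sym (extend-+ (λ v′ → c * K v v′) (λ v′ → extend (λ v → K v v′) p) q))

  coeff-⊕ : ∀ p q w → coeff (p ⊕ q) w ≡ coeff p w + coeff q w
  coeff-⊕ p q w = trans (coeff-as-extend (p ⊕ q) w)
    (trans (extend-++ (indicator w) p q) (sym (cong₂ _+_ (coeff-as-extend p w) (coeff-as-extend q w))))

  coeff-• : ∀ k p w → coeff (k • p) w ≡ k * coeff p w
  coeff-• k p w = trans (coeff-as-extend (k • p) w)
    (trans (extend-• (indicator w) k p) (cong (k *_) (sym (coeff-as-extend p w))))

  coeff-⊖ : ∀ p q w → coeff (p ⊖ q) w ≡ coeff p w - coeff q w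
  coeff-⊖ p q w = trans (coeff-⊕ p _ w)
    (cong (coeff p w +_) (trans (coeff-• (- 1ℚ) q w) (solve 1 (λ x → con (- 1ℚ) :* x := :- x) refl _)))

  remove : Word → Poly → Poly
  remove v = filter (λ t → ¬? (proj₂ t ≟W v))

  coeff-remove-self : ∀ v p → coeff (remove v p) v ≡ 0ℚ
  coeff-remove-self v [] = refl
  coeff-remove-self v ((c , u) ∷ p) with u ≟W v
  ... | yes _ = coeff-remove-self v p
  ... | no u≢v = trans (coeff-∷-other c (remove v p) u≢v) (coeff-remove-self v p)

  coeff-remove-other : ∀ {v w} p → v ≢ w → coeff (remove v p) w ≡ coeff p w
  coeff-remove-other [] v≢w = refl
  coeff-remove-other {v} {w} ((c , u) ∷ p) v≢w with u ≟W v
  ... | yes refl = trans (coeff-remove-other p v≢w) (sym (coeff-∷-other c p v≢w))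
  ... | no _ = trans (coeff-∷ c u (remove v p) w)
    (trans (cong (_+_ (c * indicator w u)) (coeff-remove-other p v≢w)) (sym (coeff-∷ c u p w)))

  extend-remove : ∀ g v p → extend g p ≡ coeff p v * g v + extend g (remove v p)
  extend-remove g v [] = sym (trans (cong (_+ 0ℚ) (*-zeroˡ (g v))) (+-identityʳ 0ℚ))
  extend-remove g v ((c , u) ∷ p) with u ≟W v
  ... | yes refl = trans (cong (_+_ (c * g u)) (extend-remove g u p))
    (solve 4 (λ c k x r → c :* x :+ (k :* x :+ r) := (c :+ k) :* x :+ r) refl c (coeff p u) (g u) _)
  ... | no _ = trans (cong (_+_ (c * g u)) (extend-remove g v p))
    (solve 3 (λ a b r → a :+ (b :+ r) := b :+ (a :+ r)) refl (c * g u) (coeff p v * g v) _)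

  extend-vanishing : ∀ {n} g p → length p ℕ.≤ n → (∀ w → coeff p w ≡ 0ℚ) → extend g p ≡ 0ℚ
  extend-vanishing g [] _ _ = refl
  extend-vanishing {suc n} g ((c , v) ∷ p) (s≤s |p|≤n) p≈0 = begin
    c * g v + extend g p                                 ≡⟨ cong (_+_ (c * g v)) (extend-remove g v p) ⟩
    c * g v + (coeff p v * g v + extend g (remove v p))  ≡⟨ collect c (coeff p v) (g v) _ ⟩
    (c + coeff p v) * g v + extend g (remove v p)        ≡⟨ cong₂ _+_ (cong (_* g v) head≈0) rest≈0 ⟩
    0ℚ * g v + 0ℚ                                        ≡⟨ trans (+-identityʳ _) (*-zeroˡ (g v)) ⟩
    0ℚ                                                   ∎
    where
    open ≡-Reasoning
    collect : ∀ c k x r → c * x + (k * x + r) ≡ (c + k) * x + r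
    collect = solve 4 (λ c k x r → c :* x :+ (k :* x :+ r) := (c :+ k) :* x :+ r) refl
    head≈0 : c + coeff p v ≡ 0ℚ
    head≈0 = trans (sym (coeff-∷-self c v p)) (p≈0 v)
    removed≈0 : ∀ w → coeff (remove v p) w ≡ 0ℚ
    removed≈0 w with v ≟W w
    ... | yes refl = coeff-remove-self v p
    ... | no v≢w   = trans (coeff-remove-other p v≢w) (trans (sym (coeff-∷-other c p v≢w)) (p≈0 w))
    rest≈0 : extend g (remove v p) ≡ 0ℚ
    rest≈0 = extend-vanishing g (remove v p) (ℕ.≤-trans (List.length-filter _ p) |p|≤n) removed≈0

  -- _≈_ unfolds to a Π-type, so its endpoints cannot be inferred from a proof; this record
  -- wrapper makes them inferable.
  infix 4 _≋_
  record _≋_ (p q : Poly) : Set where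
    constructor coeffwise
    field coeff≡ : p ≈ q
  open _≋_ public

  ≋-isEquivalence : IsEquivalence _≋_
  ≋-isEquivalence = record
    { refl  = coeffwise (λ _ → refl)
    ; sym   = λ p≋q → coeffwise (λ w → sym (coeff≡ p≋q w))
    ; trans = λ p≋q q≋r → coeffwise (λ w → trans (coeff≡ p≋q w) (coeff≡ q≋r w))
    }

  ≋-setoid : Setoid 0ℓ 0ℓ
  ≋-setoid = record { isEquivalence = ≋-isEquivalence }

  open IsEquivalence ≋-isEquivalence public
    using () renaming (refl to ≋-refl; sym to ≋-sym; trans to ≋-trans; reflexive to ≋-reflexive)

  module ≋-Reasoning = Relation.Binary.Reasoning.Setoid ≋-setoid

  extend-resp : ∀ g {p q} → p ≋ q → extend g p ≡ extend g q
  extend-resp g {p} {q} p≋q = begin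
    extend g p                                       ≡⟨ regroup (extend g p) (extend g q) ⟩
    (extend g p + (- 1ℚ) * extend g q) + extend g q  ≡⟨ cong (_+ extend g q) difference≡0 ⟩
    0ℚ + extend g q                                  ≡⟨ +-identityˡ _ ⟩
    extend g q                                       ∎
    where
    open ≡-Reasoning
    regroup : ∀ a b → a ≡ (a + (- 1ℚ) * b) + b
    regroup = solve 2 (λ a b → a := (a :+ con (- 1ℚ) :* b) :+ b) refl
    p⊖q≈0 : ∀ w → coeff (p ⊖ q) w ≡ 0ℚ
    p⊖q≈0 w = trans (coeff-⊖ p q w) (trans (cong (_- coeff q w) (coeff≡ p≋q w)) (+-inverseʳ (coeff q w)))
    difference≡0 : extend g p + (- 1ℚ) * extend g q ≡ 0ℚ
    difference≡0 = trans (sym (trans (extend-++ g p _) (cong (_+_ (extend g p)) (extend-• g (- 1ℚ) q))))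
                         (extend-vanishing g (p ⊖ q) ℕ.≤-refl p⊖q≈0)

  ⊕-cong : ∀ {p p′ q q′} → p ≋ p′ → q ≋ q′ → p ⊕ q ≋ p′ ⊕ q′
  ⊕-cong {p} {p′} {q} {q′} p≋p′ q≋q′ = coeffwise λ w →
    trans (coeff-⊕ p q w) (trans (cong₂ _+_ (coeff≡ p≋p′ w) (coeff≡ q≋q′ w)) (sym (coeff-⊕ p′ q′ w)))

  ⊕-congˡ : ∀ p {q q′} → q ≋ q′ → p ⊕ q ≋ p ⊕ q′
  ⊕-congˡ p = ⊕-cong (≋-refl {p})

  ⊕-congʳ : ∀ q {p p′} → p ≋ p′ → p ⊕ q ≋ p′ ⊕ q
  ⊕-congʳ q p≋p′ = ⊕-cong p≋p′ (≋-refl {q})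

  •-cong : ∀ k {p q} → p ≋ q → k • p ≋ k • q
  •-cong k {p} {q} p≋q = coeffwise λ w →
    trans (coeff-• k p w) (trans (cong (k *_) (coeff≡ p≋q w)) (sym (coeff-• k q w)))

  ⊕-comm : ∀ p q → p ⊕ q ≋ q ⊕ p
  ⊕-comm p q = coeffwise λ w →
    trans (coeff-⊕ p q w) (trans (+-comm (coeff p w) (coeff q w)) (sym (coeff-⊕ q p w)))

  ⊕-commutativeSemigroup : CommutativeSemigroup 0ℓ 0ℓ
  ⊕-commutativeSemigroup = record
    { _≈_ = _≋_
    ; _∙_ = _⊕_
    ; isCommutativeSemigroup = record
      { isSemigroup = record
        { isMagma = record { isEquivalence = ≋-isEquivalence ; ∙-cong = ⊕-cong }
        ; assoc   = λ p q r → ≋-reflexive (List.++-assoc p q r)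
        }
      ; comm = ⊕-comm
      }
    }

  •-identityˡ : ∀ p → 1ℚ • p ≋ p
  •-identityˡ p = coeffwise λ w → trans (coeff-• 1ℚ p w) (*-identityˡ _)

  •-assoc : ∀ k l p → k • (l • p) ≋ (k * l) • p
  •-assoc k l p = coeffwise λ w → begin
    coeff (k • (l • p)) w     ≡⟨ coeff-• k (l • p) w ⟩
    k * coeff (l • p) w       ≡⟨ cong (k *_) (coeff-• l p w) ⟩
    k * (l * coeff p w)       ≡⟨ *-assoc k l _ ⟨
    k * l * coeff p w         ≡⟨ coeff-• (k * l) p w ⟨
    coeff ((k * l) • p) w     ∎
    where open ≡-Reasoning

  •-distribˡ : ∀ k p q → k • (p ⊕ q) ≋ k • p ⊕ k • q
  •-distribˡ k p q = ≋-reflexive (List.map-++ _ p q)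

  p⊕k•p≋[1+k]•p : ∀ k p → p ⊕ k • p ≋ (1ℚ + k) • p
  p⊕k•p≋[1+k]•p k p = coeffwise λ w → begin
    coeff (p ⊕ k • p) w         ≡⟨ coeff-⊕ p (k • p) w ⟩
    coeff p w + coeff (k • p) w ≡⟨ cong (_+_ (coeff p w)) (coeff-• k p w) ⟩
    coeff p w + k * coeff p w   ≡⟨ solve 2 (λ x k → x :+ k :* x := (con 1ℚ :+ k) :* x) refl (coeff p w) k ⟩
    (1ℚ + k) * coeff p w        ≡⟨ coeff-• (1ℚ + k) p w ⟨
    coeff ((1ℚ + k) • p) w      ∎
    where open ≡-Reasoning

  [p⊕q]⊖p≋q : ∀ p q → (p ⊕ q) ⊖ p ≋ q
  [p⊕q]⊖p≋q p q = coeffwise λ w → begin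
    coeff ((p ⊕ q) ⊖ p) w               ≡⟨ coeff-⊖ (p ⊕ q) p w ⟩
    coeff (p ⊕ q) w - coeff p w         ≡⟨ cong (_- coeff p w) (coeff-⊕ p q w) ⟩
    coeff p w + coeff q w - coeff p w   ≡⟨ solve 2 (λ a b → a :+ b :- a := b) refl (coeff p w) (coeff q w) ⟩
    coeff q w                           ∎
    where open ≡-Reasoning

  [p⊖q]⊕q≋p : ∀ p q → (p ⊖ q) ⊕ q ≋ p
  [p⊖q]⊕q≋p p q = coeffwise λ w → begin
    coeff ((p ⊖ q) ⊕ q) w               ≡⟨ coeff-⊕ (p ⊖ q) q w ⟩
    coeff (p ⊖ q) w + coeff q w         ≡⟨ cong (_+ coeff q w) (coeff-⊖ p q w) ⟩
    coeff p w - coeff q w + coeff q w   ≡⟨ solve 2 (λ a b → a :- b :+ b := a) refl (coeff p w) (coeff q w) ⟩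
    coeff p w                           ∎
    where open ≡-Reasoning

  p⊖p≋0 : ∀ p → p ⊖ p ≋ []
  p⊖p≋0 p = coeffwise λ w → trans (coeff-⊖ p p w) (+-inverseʳ (coeff p w))

  [l•p⊖q]⊖k•q≋l•[p⊖q] : ∀ {k l} → l ≡ 1ℚ + k →
    ∀ p q → (l • p ⊖ q) ⊖ k • q ≋ l • (p ⊖ q)
  [l•p⊖q]⊖k•q≋l•[p⊖q] {k} {l} refl p q = coeffwise λ w → begin
    coeff ((l • p ⊖ q) ⊖ k • q) w                ≡⟨ coeff-⊖ (l • p ⊖ q) (k • q) w ⟩
    coeff (l • p ⊖ q) w - coeff (k • q) w        ≡⟨ cong₂ _-_ (coeff-⊖ (l • p) q w) (coeff-• k q w) ⟩
    coeff (l • p) w - coeff q w - k * coeff q w  ≡⟨ cong (λ z → z - coeff q w - k * coeff q w) (coeff-• l p w) ⟩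
    l * coeff p w - coeff q w - k * coeff q w    ≡⟨ telescope k (coeff p w) (coeff q w) ⟩
    l * (coeff p w - coeff q w)                  ≡⟨ cong (l *_) (coeff-⊖ p q w) ⟨
    l * coeff (p ⊖ q) w                          ≡⟨ coeff-• l (p ⊖ q) w ⟨
    coeff (l • (p ⊖ q)) w                        ∎
    where
    open ≡-Reasoning
    telescope : ∀ k a b → (1ℚ + k) * a - b - k * b ≡ (1ℚ + k) * (a - b)
    telescope = solve 3 (λ k a b → (con 1ℚ :+ k) :* a :- b :- k :* b := (con 1ℚ :+ k) :* (a :- b)) refl

  sumP-applyUpTo-suc : ∀ (f : ℕ → Poly) g k →
    sumP (map f (applyUpTo g (suc k))) ≋ sumP (map f (applyUpTo g k)) ⊕ f (g k)
  sumP-applyUpTo-suc f g zero = ≋-reflexive (List.++-identityʳ (f (g 0)))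
  sumP-applyUpTo-suc f g (suc k) =
    ≋-trans (⊕-congˡ (f (g 0)) (sumP-applyUpTo-suc f (λ i → g (suc i)) k))
            (≋-reflexive (sym (List.++-assoc (f (g 0)) (sumP (map f (applyUpTo (λ i → g (suc i)) k))) _)))

  sumP-vanishing : ∀ (f : ℕ → Poly) g k →
    (∀ i → i ℕ.< k → f (g i) ≋ []) → sumP (map f (applyUpTo g k)) ≋ []
  sumP-vanishing f g zero _ = ≋-refl
  sumP-vanishing f g (suc k) f≋0 =
    ⊕-cong (f≋0 0 (s≤s ℕ.z≤n)) (sumP-vanishing f (λ i → g (suc i)) k (λ i i<k → f≋0 (suc i) (s≤s i<k)))

  const-∸ : ∀ p {i m} → i ℕ.< m → const p (m ∸ i) ≡ 0P
  const-∸ p {zero} {suc m} _ = refl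
  const-∸ p {suc i} {suc m} (s≤s i<m) = const-∸ p i<m

module LinearMaps (N : ℕ) where
  open Alg N
  open Coefficients N

  -- F is determined termwise by its values on words.  Quantifying over all functionals
  -- extend g (rather than only coefficients) makes the notion closed under composition.
  record Linear (F : Poly → Poly) : Set where
    field termwise : ∀ g p → extend g (F p) ≡ extend (λ v → extend g (F (mon v))) p
  open Linear public

  module _ {F : Poly → Poly} (F-linear : Linear F) where

    coeff-linear : ∀ p w → coeff (F p) w ≡ extend (λ v → coeff (F (mon v)) w) p
    coeff-linear p w = begin
      coeff (F p) w                                       ≡⟨ coeff-as-extend (F p) w ⟩
      extend (indicator w) (F p)                          ≡⟨ termwise F-linear (indicator w) p ⟩
      extend (λ v → extend (indicator w) (F (mon v))) p
        ≡⟨ extend-cong (λ v → coeff-as-extend (F (mon v)) w) p ⟨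
      extend (λ v → coeff (F (mon v)) w) p                ∎
      where open ≡-Reasoning

    linear-cong : ∀ {p q} → p ≋ q → F p ≋ F q
    linear-cong {p} {q} p≋q = coeffwise λ w →
      trans (coeff-linear p w) (trans (extend-resp _ p≋q) (sym (coeff-linear q w)))

    linear-additive : ∀ p q → F (p ⊕ q) ≋ F p ⊕ F q
    linear-additive p q = coeffwise λ w → begin
      coeff (F (p ⊕ q)) w                          ≡⟨ coeff-linear (p ⊕ q) w ⟩
      extend (λ v → coeff (F (mon v)) w) (p ⊕ q)   ≡⟨ extend-++ _ p q ⟩
      extend (λ v → coeff (F (mon v)) w) p + extend (λ v → coeff (F (mon v)) w) q
        ≡⟨ cong₂ _+_ (coeff-linear p w) (coeff-linear q w) ⟨
      coeff (F p) w + coeff (F q) w                ≡⟨ coeff-⊕ (F p) (F q) w ⟨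
      coeff (F p ⊕ F q) w                          ∎
      where open ≡-Reasoning

    linear-homogeneous : ∀ k p → F (k • p) ≋ k • F p
    linear-homogeneous k p = coeffwise λ w → begin
      coeff (F (k • p)) w                         ≡⟨ coeff-linear (k • p) w ⟩
      extend (λ v → coeff (F (mon v)) w) (k • p)  ≡⟨ extend-• _ k p ⟩
      k * extend (λ v → coeff (F (mon v)) w) p    ≡⟨ cong (k *_) (coeff-linear p w) ⟨
      k * coeff (F p) w                           ≡⟨ coeff-• k (F p) w ⟨
      coeff (k • F p) w                           ∎
      where open ≡-Reasoning

    linear-zero : F [] ≋ []
    linear-zero = coeffwise (coeff-linear [])

  linear-ext : ∀ {F G} → Linear F → Linear G → (∀ v → F (mon v) ≋ G (mon v)) → ∀ p → F p ≋ G p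
  linear-ext {F} {G} F-linear G-linear F≋G p = coeffwise λ w →
    trans (coeff-linear F-linear p w)
      (trans (extend-cong (λ v → coeff≡ (F≋G v) w) p) (sym (coeff-linear G-linear p w)))

  linear-id : Linear (λ p → p)
  linear-id = record { termwise = λ g p → extend-cong (λ v → sym (extend-mon g v)) p }

  linear-∘ : ∀ {F G} → Linear F → Linear G → Linear (λ p → F (G p))
  linear-∘ {F} {G} F-linear G-linear = record { termwise = λ g p →
    trans (termwise F-linear g (G p))
      (trans (termwise G-linear (λ v → extend g (F (mon v))) p)
             (extend-cong (λ v → sym (termwise F-linear g (G (mon v)))) p)) }

  linear-⊕ : ∀ {F G} → Linear F → Linear G → Linear (λ p → F p ⊕ G p)
  linear-⊕ {F} {G} F-linear G-linear = record { termwise = λ g p → begin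
    extend g (F p ⊕ G p)                    ≡⟨ extend-++ g (F p) (G p) ⟩
    extend g (F p) + extend g (G p)         ≡⟨ cong₂ _+_ (termwise F-linear g p) (termwise G-linear g p) ⟩
    extend (λ v → extend g (F (mon v))) p + extend (λ v → extend g (G (mon v))) p
      ≡⟨ extend-+ (λ v → extend g (F (mon v))) (λ v → extend g (G (mon v))) p ⟨
    extend (λ v → extend g (F (mon v)) + extend g (G (mon v))) p
      ≡⟨ extend-cong (λ v → extend-++ g (F (mon v)) (G (mon v))) p ⟨
    extend (λ v → extend g (F (mon v) ⊕ G (mon v))) p ∎ }
    where open ≡-Reasoning

  linear-• : ∀ {F} k → Linear F → Linear (λ p → k • F p)
  linear-• {F} k F-linear = record { termwise = λ g p → begin
    extend g (k • F p)                          ≡⟨ extend-• g k (F p) ⟩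
    k * extend g (F p)                          ≡⟨ cong (k *_) (termwise F-linear g p) ⟩
    k * extend (λ v → extend g (F (mon v))) p   ≡⟨ extend-* k (λ v → extend g (F (mon v))) p ⟨
    extend (λ v → k * extend g (F (mon v))) p   ≡⟨ extend-cong (λ v → extend-• g k (F (mon v))) p ⟨
    extend (λ v → extend g (k • F (mon v))) p   ∎ }
    where open ≡-Reasoning

  linear-⊖ : ∀ {F G} → Linear F → Linear G → Linear (λ p → F p ⊖ G p)
  linear-⊖ F-linear G-linear = linear-⊕ F-linear (linear-• (- 1ℚ) G-linear)

module Products (N : ℕ) where
  open Alg N
  open Coefficients N
  open LinearMaps N

  shuffleWords : Word → Word → Poly
  shuffleWords u v = map (1ℚ ,_) (shW u v)

  extend-scaledWords : ∀ g k l → extend g (map (k ,_) l) ≡ k * extend g (map (1ℚ ,_) l)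
  extend-scaledWords g k [] = sym (*-zeroʳ k)
  extend-scaledWords g k (s ∷ l) =
    trans (cong₂ _+_ (cong (k *_) (sym (*-identityˡ (g s)))) (extend-scaledWords g k l))
          (sym (*-distribˡ-+ k _ _))

  ·-∷ : ∀ t p q → (t ∷ p) · q ≡ (t ∷ []) · q ++ p · q
  ·-∷ t p q = cong (_++ p · q) (sym (List.++-identityʳ _))

  extend-term-· : ∀ g c v q → extend g (((c , v) ∷ []) · q) ≡ c * extend (λ w → g (v ++ w)) q
  extend-term-· g c v [] = sym (*-zeroʳ c)
  extend-term-· g c v ((c′ , w) ∷ q) =
    trans (cong₂ _+_ (*-assoc c c′ (g (v ++ w))) (extend-term-· g c v q)) (sym (*-distribˡ-+ c _ _))

  extend-· : ∀ g p q → extend g (p · q) ≡ extend (λ v → extend (λ v′ → g (v ++ v′)) q) p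
  extend-· g [] q = refl
  extend-· g ((c , v) ∷ p) q =
    trans (cong (extend g) (·-∷ (c , v) p q))
      (trans (extend-++ g (((c , v) ∷ []) · q) (p · q)) (cong₂ _+_ (extend-term-· g c v q) (extend-· g p q)))

  ⧢-∷ : ∀ t p q → (t ∷ p) ⧢ q ≡ (t ∷ []) ⧢ q ++ p ⧢ q
  ⧢-∷ t p q = cong (_++ p ⧢ q) (sym (List.++-identityʳ _))

  extend-term-⧢ : ∀ g c v q →
    extend g (((c , v) ∷ []) ⧢ q) ≡ c * extend (λ w → extend g (shuffleWords v w)) q
  extend-term-⧢ g c v [] = sym (*-zeroʳ c)
  extend-term-⧢ g c v ((c′ , w) ∷ q) = begin
    extend g ((first ++ _) ++ [])                    ≡⟨ cong (extend g) (List.++-assoc first _ []) ⟩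
    extend g (first ++ ((c , v) ∷ []) ⧢ q)           ≡⟨ extend-++ g first (((c , v) ∷ []) ⧢ q) ⟩
    extend g first + extend g (((c , v) ∷ []) ⧢ q)   ≡⟨ cong₂ _+_ (extend-scaledWords g (c * c′) (shW v w))
                                                                   (extend-term-⧢ g c v q) ⟩
    c * c′ * extend g (shuffleWords v w) + c * rest  ≡⟨ cong (_+ c * rest) (*-assoc c c′ _) ⟩
    c * (c′ * extend g (shuffleWords v w)) + c * rest ≡⟨ *-distribˡ-+ c _ rest ⟨
    c * (c′ * extend g (shuffleWords v w) + rest)    ∎
    where
    open ≡-Reasoning
    first : Poly
    first = map (c * c′ ,_) (shW v w)
    rest : ℚ
    rest = extend (λ w → extend g (shuffleWords v w)) q

  extend-⧢ : ∀ g p q → extend g (p ⧢ q) ≡ extend (λ v → extend (λ v′ → extend g (shuffleWords v v′)) q) p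
  extend-⧢ g [] q = refl
  extend-⧢ g ((c , v) ∷ p) q =
    trans (cong (extend g) (⧢-∷ (c , v) p q))
      (trans (extend-++ g (((c , v) ∷ []) ⧢ q) (p ⧢ q)) (cong₂ _+_ (extend-term-⧢ g c v q) (extend-⧢ g p q)))

  linear-·ʳ : ∀ q → Linear (λ p → p · q)
  linear-·ʳ q = record { termwise = λ g p → trans (extend-· g p q) (extend-cong (λ v → sym (on-word v)) p) }
    where
    on-word : ∀ {g} v → extend g (mon v · q) ≡ extend (λ v′ → g (v ++ v′)) q
    on-word {g} v = trans (extend-· g (mon v) q) (extend-mon (λ u → extend (λ v′ → g (u ++ v′)) q) v)

  linear-·ˡ : ∀ p → Linear (λ q → p · q)
  linear-·ˡ p = record { termwise = λ g q → begin
    extend g (p · q)                                ≡⟨ extend-· g p q ⟩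
    extend (λ v → extend (λ v′ → g (v ++ v′)) q) p  ≡⟨ extend-swap (λ v v′ → g (v ++ v′)) p q ⟩
    extend (λ v′ → extend (λ v → g (v ++ v′)) p) q  ≡⟨ extend-cong (λ v′ → sym (on-word v′)) q ⟩
    extend (λ v′ → extend g (p · mon v′)) q         ∎ }
    where
    open ≡-Reasoning
    on-word : ∀ {g} v′ → extend g (p · mon v′) ≡ extend (λ v → g (v ++ v′)) p
    on-word {g} v′ = trans (extend-· g p (mon v′)) (extend-cong (λ v → extend-mon (λ u → g (v ++ u)) v′) p)

  linear-⧢ : ∀ p → Linear (λ q → p ⧢ q)
  linear-⧢ p = record { termwise = λ g q → begin
    extend g (p ⧢ q)                                                  ≡⟨ extend-⧢ g p q ⟩
    extend (λ v → extend (λ v′ → extend g (shuffleWords v v′)) q) p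
      ≡⟨ extend-swap (λ v v′ → extend g (shuffleWords v v′)) p q ⟩
    extend (λ v′ → extend (λ v → extend g (shuffleWords v v′)) p) q
      ≡⟨ extend-cong (λ v′ → sym (on-word v′)) q ⟩
    extend (λ v′ → extend g (p ⧢ mon v′)) q                           ∎ }
    where
    open ≡-Reasoning
    on-word : ∀ {g} v′ → extend g (p ⧢ mon v′) ≡ extend (λ v → extend g (shuffleWords v v′)) p
    on-word {g} v′ = trans (extend-⧢ g p (mon v′))
      (extend-cong (λ v → extend-mon (λ u → extend g (shuffleWords v u)) v′) p)

  ·-congˡ : ∀ p {q q′} → q ≋ q′ → p · q ≋ p · q′
  ·-congˡ p = linear-cong (linear-·ˡ p)

  ·-congʳ : ∀ {p p′} q → p ≋ p′ → p · q ≋ p′ · q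
  ·-congʳ q = linear-cong (linear-·ʳ q)

  ·-distribˡ : ∀ p q r → p · (q ⊕ r) ≋ p · q ⊕ p · r
  ·-distribˡ p = linear-additive (linear-·ˡ p)

  ·-distribʳ : ∀ r p q → (p ⊕ q) · r ≋ p · r ⊕ q · r
  ·-distribʳ r = linear-additive (linear-·ʳ r)

  ·-•ˡ : ∀ k p q → (k • p) · q ≋ k • (p · q)
  ·-•ˡ k p q = linear-homogeneous (linear-·ʳ q) k p

  ·-•ʳ : ∀ k p q → p · (k • q) ≋ k • (p · q)
  ·-•ʳ k p q = linear-homogeneous (linear-·ˡ p) k q

  ⧢-congˡ : ∀ p {q q′} → q ≋ q′ → p ⧢ q ≋ p ⧢ q′
  ⧢-congˡ p = linear-cong (linear-⧢ p)

  ⧢-distribˡ : ∀ p q r → p ⧢ (q ⊕ r) ≋ p ⧢ q ⊕ p ⧢ r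
  ⧢-distribˡ p = linear-additive (linear-⧢ p)

  ·-assoc : ∀ p q r → (p · q) · r ≋ p · (q · r)
  ·-assoc p q r = coeffwise λ w →
    trans (coeff-as-extend ((p · q) · r) w)
      (trans (extend-assoc (indicator w)) (sym (coeff-as-extend (p · (q · r)) w)))
    where
    open ≡-Reasoning
    extend-assoc : ∀ g → extend g ((p · q) · r) ≡ extend g (p · (q · r))
    extend-assoc g = begin
      extend g ((p · q) · r)                                                    ≡⟨ extend-· g (p · q) r ⟩
      extend (λ u → extend (λ u′ → g (u ++ u′)) r) (p · q)                      ≡⟨ extend-· _ p q ⟩
      extend (λ v → extend (λ v′ → extend (λ u′ → g ((v ++ v′) ++ u′)) r) q) p
        ≡⟨ extend-cong (λ v → extend-cong (λ v′ →
             extend-cong (λ u′ → cong g (List.++-assoc v v′ u′)) r) q) p ⟩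
      extend (λ v → extend (λ v′ → extend (λ u′ → g (v ++ (v′ ++ u′))) r) q) p
        ≡⟨ extend-cong (λ v → extend-· (λ u → g (v ++ u)) q r) p ⟨
      extend (λ v → extend (λ u → g (v ++ u)) (q · r)) p                        ≡⟨ extend-· g p (q · r) ⟨
      extend g (p · (q · r))                                                    ∎

  1·p≋p : ∀ p → mon [] · p ≋ p
  1·p≋p = linear-ext (linear-·ˡ (mon [])) linear-id (λ _ → ≋-refl)

  mon⧢mon : ∀ u v → mon u ⧢ mon v ≋ shuffleWords u v
  mon⧢mon u v = ≋-reflexive (trans (List.++-identityʳ _) (List.++-identityʳ _))

  1⧢p≋p : ∀ p → mon [] ⧢ p ≋ p
  1⧢p≋p = linear-ext (linear-⧢ (mon [])) linear-id (λ v → mon⧢mon [] v)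

  mon⧢1 : ∀ u → mon u ⧢ mon [] ≋ mon u
  mon⧢1 [] = mon⧢mon [] []
  mon⧢1 (x ∷ u) = mon⧢mon (x ∷ u) []

  shuffleWords-∷ : ∀ x l → map (1ℚ ,_) (map (x ∷_) l) ≡ mon (x ∷ []) · map (1ℚ ,_) l
  shuffleWords-∷ x [] = refl
  shuffleWords-∷ x (s ∷ l) = cong ((1ℚ , x ∷ s) ∷_) (shuffleWords-∷ x l)

  letter : Letter → Poly
  letter y = mon (y ∷ [])

  shuffle-∷-∷ : ∀ y z u v →
    mon (y ∷ u) ⧢ mon (z ∷ v) ≋ letter y · (mon u ⧢ mon (z ∷ v)) ⊕ letter z · (mon (y ∷ u) ⧢ mon v)
  shuffle-∷-∷ y z u v = begin
    mon (y ∷ u) ⧢ mon (z ∷ v)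
      ≈⟨ mon⧢mon (y ∷ u) (z ∷ v) ⟩
    map (1ℚ ,_) (map (y ∷_) (shW u (z ∷ v)) ++ map (z ∷_) (shW (y ∷ u) v))
      ≡⟨ List.map-++ (1ℚ ,_) (map (y ∷_) (shW u (z ∷ v))) _ ⟩
    map (1ℚ ,_) (map (y ∷_) (shW u (z ∷ v))) ⊕ map (1ℚ ,_) (map (z ∷_) (shW (y ∷ u) v))
      ≡⟨ cong₂ _⊕_ (shuffleWords-∷ y (shW u (z ∷ v))) (shuffleWords-∷ z (shW (y ∷ u) v)) ⟩
    letter y · shuffleWords u (z ∷ v) ⊕ letter z · shuffleWords (y ∷ u) v
      ≈⟨ ⊕-cong (·-congˡ (letter y) (mon⧢mon u (z ∷ v))) (·-congˡ (letter z) (mon⧢mon (y ∷ u) v)) ⟨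
    letter y · (mon u ⧢ mon (z ∷ v)) ⊕ letter z · (mon (y ∷ u) ⧢ mon v) ∎
    where open ≋-Reasoning

  letter-⧢-∷ : ∀ y z p →
    letter y ⧢ (letter z · p) ≋ letter y · (letter z · p) ⊕ letter z · (letter y ⧢ p)
  letter-⧢-∷ y z = linear-ext
    (linear-∘ (linear-⧢ (letter y)) (linear-·ˡ (letter z)))
    (linear-⊕ (linear-∘ (linear-·ˡ (letter y)) (linear-·ˡ (letter z)))
              (linear-∘ (linear-·ˡ (letter z)) (linear-⧢ (letter y))))
    λ v → ≋-trans (shuffle-∷-∷ y z [] v)
                  (⊕-congʳ (letter z · (letter y ⧢ mon v)) (·-congˡ (letter y) (1⧢p≋p (mon (z ∷ v)))))

module Derivation (N : ℕ) (x : Alg.Letter N) where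
  open Alg N
  open Coefficients N
  open LinearMaps N
  open Products N
  open ≋-Reasoning
  open import Algebra.Properties.CommutativeSemigroup ⊕-commutativeSemigroup
    using (interchange; xy∙z≈xz∙y)

  X : Poly
  X = letter x

  ∂ : Poly → Poly
  ∂ p = X ⧢ p ⊖ X · p

  ∂-linear : Linear ∂
  ∂-linear = linear-⊖ (linear-⧢ X) (linear-·ˡ X)

  ∂-1 : ∂ (mon []) ≋ []
  ∂-1 = ≋-trans (⊕-congʳ ((- 1ℚ) • X) (mon⧢1 (x ∷ []))) (p⊖p≋0 X)

  ∂[y·p]≋y·[X⧢p] : ∀ y p → ∂ (letter y · p) ≋ letter y · (X ⧢ p)
  ∂[y·p]≋y·[X⧢p] y p = ≋-trans (⊕-congʳ ((- 1ℚ) • (X · (letter y · p))) (letter-⧢-∷ x y p))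
                                ([p⊕q]⊖p≋q (X · (letter y · p)) (letter y · (X ⧢ p)))

  X⧢p≋∂p⊕X·p : ∀ p → X ⧢ p ≋ ∂ p ⊕ X · p
  X⧢p≋∂p⊕X·p p = ≋-sym ([p⊖q]⊕q≋p (X ⧢ p) (X · p))

  ∂-leibniz-mon : ∀ u q → ∂ (mon u · q) ≋ ∂ (mon u) · q ⊕ mon u · ∂ q
  ∂-leibniz-mon [] q = begin
    ∂ (mon [] · q)                  ≈⟨ linear-cong ∂-linear (1·p≋p q) ⟩
    ∂ q                             ≈⟨ 1·p≋p (∂ q) ⟨
    [] · q ⊕ mon [] · ∂ q           ≈⟨ ⊕-congʳ (mon [] · ∂ q) (·-congʳ q ∂-1) ⟨
    ∂ (mon []) · q ⊕ mon [] · ∂ q   ∎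
  ∂-leibniz-mon (y ∷ u) q = begin
    ∂ ((Y · U) · q)
      ≈⟨ linear-cong ∂-linear (·-assoc Y U q) ⟩
    ∂ (Y · (U · q))
      ≈⟨ ∂[y·p]≋y·[X⧢p] y (U · q) ⟩
    Y · (X ⧢ (U · q))
      ≈⟨ ·-congˡ Y (X⧢p≋∂p⊕X·p (U · q)) ⟩
    Y · (∂ (U · q) ⊕ X · (U · q))
      ≈⟨ ·-congˡ Y (⊕-congʳ (X · (U · q)) (∂-leibniz-mon u q)) ⟩
    Y · ((∂ U · q ⊕ U · ∂ q) ⊕ X · (U · q))
      ≈⟨ ·-congˡ Y (xy∙z≈xz∙y (∂ U · q) (U · ∂ q) (X · (U · q))) ⟩
    Y · ((∂ U · q ⊕ X · (U · q)) ⊕ U · ∂ q)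
      ≈⟨ ·-congˡ Y (⊕-congʳ (U · ∂ q) (⊕-congˡ (∂ U · q) (·-assoc X U q))) ⟨
    Y · ((∂ U · q ⊕ (X · U) · q) ⊕ U · ∂ q)
      ≈⟨ ·-congˡ Y (⊕-congʳ (U · ∂ q) (·-distribʳ q (∂ U) (X · U))) ⟨
    Y · ((∂ U ⊕ X · U) · q ⊕ U · ∂ q)
      ≈⟨ ·-congˡ Y (⊕-congʳ (U · ∂ q) (·-congʳ q (X⧢p≋∂p⊕X·p U))) ⟨
    Y · ((X ⧢ U) · q ⊕ U · ∂ q)
      ≈⟨ ·-distribˡ Y ((X ⧢ U) · q) (U · ∂ q) ⟩
    Y · ((X ⧢ U) · q) ⊕ Y · (U · ∂ q)
      ≈⟨ ⊕-cong (·-assoc Y (X ⧢ U) q) (·-assoc Y U (∂ q)) ⟨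
    (Y · (X ⧢ U)) · q ⊕ (Y · U) · ∂ q
      ≈⟨ ⊕-congʳ ((Y · U) · ∂ q) (·-congʳ q (∂[y·p]≋y·[X⧢p] y U)) ⟨
    ∂ (Y · U) · q ⊕ (Y · U) · ∂ q
      ∎
    where
    Y U : Poly
    Y = letter y
    U = mon u

  ∂-leibniz : ∀ p q → ∂ (p · q) ≋ ∂ p · q ⊕ p · ∂ q
  ∂-leibniz p q = linear-ext
    (linear-∘ ∂-linear (linear-·ʳ q))
    (linear-⊕ (linear-∘ (linear-·ʳ q) ∂-linear) (linear-·ʳ (∂ q)))
    (λ u → ∂-leibniz-mon u q) p

  ∂-isDerivation : IsDerivation ∂
  ∂-isDerivation =
      (λ p q p≈q → coeff≡ (linear-cong ∂-linear {p} {q} (coeffwise p≈q)))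
    , (λ p q → coeff≡ (linear-additive ∂-linear p q))
    , (λ k p → coeff≡ (linear-homogeneous ∂-linear k p))
    , (λ p q → coeff≡ (∂-leibniz p q))

  pow : ℕ → Poly
  pow n = mon (replicate n x)

  X⧢pow : ∀ n → X ⧢ pow n ≋ ι (suc n) • pow (suc n)
  X⧢pow zero = ≋-trans (mon⧢1 (x ∷ [])) (≋-sym (•-identityˡ X))
  X⧢pow (suc n) = begin
    X ⧢ (X · pow n)
      ≈⟨ letter-⧢-∷ x x (pow n) ⟩
    X · (X · pow n) ⊕ X · (X ⧢ pow n)
      ≈⟨ ⊕-congˡ (X · pow (suc n)) (·-congˡ X (X⧢pow n)) ⟩
    X · pow (suc n) ⊕ X · (k • pow (suc n))
      ≈⟨ ⊕-congˡ (X · pow (suc n)) (·-•ʳ k X (pow (suc n))) ⟩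
    X · pow (suc n) ⊕ k • (X · pow (suc n))
      ≈⟨ p⊕k•p≋[1+k]•p k (X · pow (suc n)) ⟩
    (1ℚ + k) • pow (suc (suc n))
      ≡⟨ cong (_• pow (suc (suc n))) (ι-suc (suc n)) ⟨
    ι (suc (suc n)) • pow (suc (suc n))
      ∎
    where
    k : ℚ
    k = ι (suc n)

  X⧢pow⧢mon-step : ∀ y v n
    → X ⧢ (pow n ⧢ mon (y ∷ v)) ≋ ι (suc n) • (pow (suc n) ⧢ mon (y ∷ v))
    → X ⧢ (pow (suc n) ⧢ mon v) ≋ ι (suc (suc n)) • (pow (suc (suc n)) ⧢ mon v)
    → X ⧢ (pow (suc n) ⧢ mon (y ∷ v)) ≋ ι (suc (suc n)) • (pow (suc (suc n)) ⧢ mon (y ∷ v))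
  X⧢pow⧢mon-step y v n ih₁ ih₂ = begin
    X ⧢ A′
      ≈⟨ ⧢-congˡ X (split n) ⟩
    X ⧢ (X · A ⊕ Y · B)
      ≈⟨ ⧢-distribˡ X (X · A) (Y · B) ⟩
    X ⧢ (X · A) ⊕ X ⧢ (Y · B)
      ≈⟨ ⊕-cong (letter-⧢-∷ x x A) (letter-⧢-∷ x y B) ⟩
    (X · (X · A) ⊕ X · (X ⧢ A)) ⊕ (X · (Y · B) ⊕ Y · (X ⧢ B))
      ≈⟨ ⊕-cong (⊕-congˡ (X · (X · A)) (·-congˡ X ih₁)) (⊕-congˡ (X · (Y · B)) (·-congˡ Y ih₂)) ⟩
    (X · (X · A) ⊕ X · (k₁ • A′)) ⊕ (X · (Y · B) ⊕ Y · (k₂ • B′))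
      ≈⟨ interchange (X · (X · A)) (X · (k₁ • A′)) (X · (Y · B)) (Y · (k₂ • B′)) ⟩
    (X · (X · A) ⊕ X · (Y · B)) ⊕ (X · (k₁ • A′) ⊕ Y · (k₂ • B′))
      ≈⟨ ⊕-cong (≋-sym (·-distribˡ X (X · A) (Y · B)))
                (⊕-cong (·-•ʳ k₁ X A′) (·-•ʳ k₂ Y B′)) ⟩
    X · (X · A ⊕ Y · B) ⊕ (k₁ • (X · A′) ⊕ k₂ • (Y · B′))
      ≈⟨ ⊕-congʳ (k₁ • (X · A′) ⊕ k₂ • (Y · B′)) (·-congˡ X (split n)) ⟨
    X · A′ ⊕ (k₁ • (X · A′) ⊕ k₂ • (Y · B′))
      ≡⟨ List.++-assoc (X · A′) (k₁ • (X · A′)) (k₂ • (Y · B′)) ⟨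
    (X · A′ ⊕ k₁ • (X · A′)) ⊕ k₂ • (Y · B′)
      ≈⟨ ⊕-congʳ (k₂ • (Y · B′)) (p⊕k•p≋[1+k]•p k₁ (X · A′)) ⟩
    (1ℚ + k₁) • (X · A′) ⊕ k₂ • (Y · B′)
      ≡⟨ cong (λ k → k • (X · A′) ⊕ k₂ • (Y · B′)) (ι-suc (suc n)) ⟨
    k₂ • (X · A′) ⊕ k₂ • (Y · B′)
      ≈⟨ •-distribˡ k₂ (X · A′) (Y · B′) ⟨
    k₂ • (X · A′ ⊕ Y · B′)
      ≈⟨ •-cong k₂ (split (suc n)) ⟨
    k₂ • (pow (suc (suc n)) ⧢ mon (y ∷ v))
      ∎
    where
    Y A A′ B B′ : Poly
    Y = letter y
    A = pow n ⧢ mon (y ∷ v)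
    A′ = pow (suc n) ⧢ mon (y ∷ v)
    B = pow (suc n) ⧢ mon v
    B′ = pow (suc (suc n)) ⧢ mon v
    k₁ k₂ : ℚ
    k₁ = ι (suc n)
    k₂ = ι (suc (suc n))
    split : ∀ m → pow (suc m) ⧢ mon (y ∷ v) ≋ X · (pow m ⧢ mon (y ∷ v)) ⊕ Y · (pow (suc m) ⧢ mon v)
    split m = shuffle-∷-∷ x y (replicate m x) v

  X⧢pow⧢mon : ∀ v n → X ⧢ (pow n ⧢ mon v) ≋ ι (suc n) • (pow (suc n) ⧢ mon v)
  X⧢pow⧢mon [] n = begin
    X ⧢ (pow n ⧢ mon [])                ≈⟨ ⧢-congˡ X (mon⧢1 (replicate n x)) ⟩
    X ⧢ pow n                           ≈⟨ X⧢pow n ⟩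
    ι (suc n) • pow (suc n)             ≈⟨ •-cong (ι (suc n)) (mon⧢1 (replicate (suc n) x)) ⟨
    ι (suc n) • (pow (suc n) ⧢ mon [])  ∎
  X⧢pow⧢mon (y ∷ v) zero =
    ≋-trans (⧢-congˡ X (1⧢p≋p (mon (y ∷ v)))) (≋-sym (•-identityˡ (X ⧢ mon (y ∷ v))))
  X⧢pow⧢mon (y ∷ v) (suc n) = X⧢pow⧢mon-step y v n (X⧢pow⧢mon (y ∷ v) n) (X⧢pow⧢mon v (suc n))

  X⧢pow⧢ : ∀ n p → X ⧢ (pow n ⧢ p) ≋ ι (suc n) • (pow (suc n) ⧢ p)
  X⧢pow⧢ n = linear-ext (linear-∘ (linear-⧢ X) (linear-⧢ (pow n)))
                        (linear-• (ι (suc n)) (linear-⧢ (pow (suc n))))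
                        (λ v → X⧢pow⧢mon v n)

  -- R n p is the coefficient of uⁿ in (1 − x u)((1 − x u)⁻¹ ⧢ p).
  R : ℕ → Poly → Poly
  R zero p = p
  R (suc n) p = pow (suc n) ⧢ p ⊖ X · (pow n ⧢ p)

  ∂-R : ∀ n p → ∂ (R n p) ≋ ι (suc n) • R (suc n) p
  ∂-R zero p = begin
    X ⧢ p ⊖ X · p              ≈⟨ ⊕-congˡ (X ⧢ p) (•-cong (- 1ℚ) (·-congˡ X (1⧢p≋p p))) ⟨
    X ⧢ p ⊖ X · (mon [] ⧢ p)   ≈⟨ •-identityˡ (R 1 p) ⟨
    1ℚ • R 1 p                 ∎
  ∂-R (suc m) p = begin
    ∂ (S₁ ⊖ X · S₀)
      ≈⟨ linear-additive ∂-linear S₁ ((- 1ℚ) • (X · S₀)) ⟩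
    ∂ S₁ ⊕ ∂ ((- 1ℚ) • (X · S₀))
      ≈⟨ ⊕-congˡ (∂ S₁) (linear-homogeneous ∂-linear (- 1ℚ) (X · S₀)) ⟩
    (X ⧢ S₁ ⊖ X · S₁) ⊖ ∂ (X · S₀)
      ≈⟨ ⊕-cong (⊕-congʳ ((- 1ℚ) • (X · S₁)) (X⧢pow⧢ (suc m) p))
                (•-cong (- 1ℚ) (∂[y·p]≋y·[X⧢p] x S₀)) ⟩
    (k₂ • S₂ ⊖ X · S₁) ⊖ X · (X ⧢ S₀)
      ≈⟨ ⊕-congˡ (k₂ • S₂ ⊖ X · S₁) (•-cong (- 1ℚ) (·-congˡ X (X⧢pow⧢ m p))) ⟩
    (k₂ • S₂ ⊖ X · S₁) ⊖ X · (k₁ • S₁)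
      ≈⟨ ⊕-congˡ (k₂ • S₂ ⊖ X · S₁) (•-cong (- 1ℚ) (·-•ʳ k₁ X S₁)) ⟩
    (k₂ • S₂ ⊖ X · S₁) ⊖ k₁ • (X · S₁)
      ≈⟨ [l•p⊖q]⊖k•q≋l•[p⊖q] (ι-suc (suc m)) S₂ (X · S₁) ⟩
    k₂ • (S₂ ⊖ X · S₁)
      ∎
    where
    S₀ S₁ S₂ : Poly
    S₀ = pow m ⧢ p
    S₁ = pow (suc m) ⧢ p
    S₂ = pow (suc (suc m)) ⧢ p
    k₁ k₂ : ℚ
    k₁ = ι (suc m)
    k₂ = ι (suc (suc m))

  iter-∂ : ∀ n p → iter n ∂ p ≋ ι (n !) • R n p
  iter-∂ zero p = ≋-sym (•-identityˡ p)
  iter-∂ (suc n) p = begin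
    ∂ (iter n ∂ p)                        ≈⟨ linear-cong ∂-linear (iter-∂ n p) ⟩
    ∂ (ι (n !) • R n p)                   ≈⟨ linear-homogeneous ∂-linear (ι (n !)) (R n p) ⟩
    ι (n !) • ∂ (R n p)                   ≈⟨ •-cong (ι (n !)) (∂-R n p) ⟩
    ι (n !) • (ι (suc n) • R (suc n) p)   ≈⟨ •-assoc (ι (n !)) (ι (suc n)) (R (suc n) p) ⟩
    (ι (n !) * ι (suc n)) • R (suc n) p
      ≡⟨ cong (_• R (suc n) p) (trans (*-comm (ι (n !)) (ι (suc n))) (ι-* (suc n) (n !))) ⟩
    ι (suc n !) • R (suc n) p             ∎

  expSeries-∂ : ∀ p n → expSeries ∂ p n ≋ R n p
  expSeries-∂ p n = begin
    1/n! • iter n ∂ p          ≈⟨ •-cong 1/n! (iter-∂ n p) ⟩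
    1/n! • (ι (n !) • R n p)   ≈⟨ •-assoc 1/n! (ι (n !)) (R n p) ⟩
    (1/n! * ι (n !)) • R n p   ≡⟨ cong (_• R n p) (1/n*ι[n]≡1 (n !) {{n !≢0}}) ⟩
    1ℚ • R n p                 ≈⟨ •-identityˡ (R n p) ⟩
    R n p                      ∎
    where
    1/n! : ℚ
    1/n! = (ℤ.+ 1 / n !) {{n !≢0}}

  R-letter : ∀ y n → R n (letter y) ≋ mon (y ∷ replicate n x)
  R-letter y zero = ≋-refl
  R-letter y (suc n) = begin
    pow (suc n) ⧢ Y ⊖ X · (pow n ⧢ Y)
      ≈⟨ ⊕-congʳ ((- 1ℚ) • (X · (pow n ⧢ Y))) (shuffle-∷-∷ x y (replicate n x) []) ⟩
    (X · (pow n ⧢ Y) ⊕ Y · (pow (suc n) ⧢ mon [])) ⊖ X · (pow n ⧢ Y)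
      ≈⟨ [p⊕q]⊖p≋q (X · (pow n ⧢ Y)) (Y · (pow (suc n) ⧢ mon [])) ⟩
    Y · (pow (suc n) ⧢ mon [])
      ≈⟨ ·-congˡ Y (mon⧢1 (replicate (suc n) x)) ⟩
    Y · pow (suc n)
      ∎
    where
    Y : Poly
    Y = letter y

module Exponential (M : ℕ) where
  open Alg (suc M)
  open AlgB M
  open Coefficients (suc M)
  open LinearMaps (suc M)
  open Products (suc M)
  open Derivation (suc M) b0
  open ≋-Reasoning

  geomB0⧢const : ∀ p m → (geomB0 ⧢s const p) m ≋ pow m ⧢ p
  geomB0⧢const p m = begin
    sumP (map f (upTo (suc m)))   ≈⟨ sumP-applyUpTo-suc f (λ i → i) m ⟩
    sumP (map f (upTo m)) ⊕ f m   ≈⟨ ⊕-congʳ (f m) (sumP-vanishing f (λ i → i) m earlier≋0) ⟩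
    f m                           ≡⟨ cong (λ j → pow m ⧢ const p j) (ℕ.n∸n≡0 m) ⟩
    pow m ⧢ p                     ∎
    where
    f : ℕ → Poly
    f i = geomB0 i ⧢ const p (m ∸ i)
    earlier≋0 : ∀ i → i ℕ.< m → f i ≋ []
    earlier≋0 i i<m = ≋-trans (≋-reflexive (cong (geomB0 i ⧢_) (const-∸ p i<m)))
                              (linear-zero (linear-⧢ (geomB0 i)))

  expSeries-d : ∀ p → expSeries d p ≈s oneMinusB0u ⊙ (geomB0 ⧢s const p)
  expSeries-d p n = coeff≡ (≋-trans (expSeries-∂ p n) (≋-sym (convolution n)))
    where
    H : Series
    H = geomB0 ⧢s const p
    convolution : ∀ n → (oneMinusB0u ⊙ H) n ≋ R n p
    convolution zero = begin
      1P · H 0 ⊕ []   ≡⟨ List.++-identityʳ (1P · H 0) ⟩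
      1P · H 0        ≈⟨ 1·p≋p (H 0) ⟩
      H 0             ≈⟨ geomB0⧢const p 0 ⟩
      mon [] ⧢ p      ≈⟨ 1⧢p≋p p ⟩
      p               ∎
    convolution (suc m) = begin
      1P · H (suc m) ⊕ (((- 1ℚ) • X) · H m ⊕ sumP (map f (applyUpTo (λ i → suc (suc i)) m)))
        ≈⟨ ⊕-congˡ (1P · H (suc m)) (⊕-congˡ (((- 1ℚ) • X) · H m)
             (sumP-vanishing f (λ i → suc (suc i)) m (λ _ _ → ≋-refl))) ⟩
      1P · H (suc m) ⊕ (((- 1ℚ) • X) · H m ⊕ [])
        ≡⟨ cong (1P · H (suc m) ⊕_) (List.++-identityʳ _) ⟩
      1P · H (suc m) ⊕ ((- 1ℚ) • X) · H m
        ≈⟨ ⊕-cong (≋-trans (1·p≋p (H (suc m))) (geomB0⧢const p (suc m)))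
                  (≋-trans (·-•ˡ (- 1ℚ) X (H m)) (•-cong (- 1ℚ) (·-congˡ X (geomB0⧢const p m)))) ⟩
      R (suc m) p
        ∎
      where
      f : ℕ → Poly
      f i = oneMinusB0u i · H (suc m ∸ i)

  expSeries-d-letter : ∀ y → expSeries d (letter y) ≈s const (letter y) ⊙ geomB0
  expSeries-d-letter y n =
    coeff≡ (≋-trans (expSeries-∂ (letter y) n) (≋-trans (R-letter y n) (≋-sym convolution)))
    where
    f : ℕ → Poly
    f i = const (letter y) i · geomB0 (n ∸ i)
    convolution : (const (letter y) ⊙ geomB0) n ≋ mon (y ∷ replicate n b0)
    convolution = ≋-trans (⊕-congˡ (f 0) (sumP-vanishing f suc n (λ _ _ → ≋-refl)))
                          (≋-reflexive (List.++-identityʳ (f 0)))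

mainTheorem13 : (M : ℕ) → let open Alg (suc M) in let open AlgB M in
    IsDerivation d
    × (∀ w → InA1 w → expSeries d w ≈s oneMinusB0u ⊙ (geomB0 ⧢s const w))
    × (expSeries d (mon (a ∷ [])) ≈s const (mon (a ∷ [])) ⊙ geomB0)
    × (∀ (j : Fin (suc M)) → expSeries d (mon (b j ∷ [])) ≈s const (mon (b j ∷ [])) ⊙ geomB0)
mainTheorem13 M =
    ∂-isDerivation
  , (λ w _ → expSeries-d w)
  , expSeries-d-letter a
  , (λ j → expSeries-d-letter (b j))
  where
  open Alg (suc M)
  open AlgB M
  open Derivation (suc M) b0
  open Exponential M
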